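{- Suppose $n=2m$ and the derangement $\sigma\in S_n$ is an involution. Then the stabilizer in $G$ of $M=I+P_\sigma$ has order $m!\,2^{n+1}$, and the $G$-orbit of $M$ has $(n!)^2/(m!\,2^{n})$ elements.
   Context: $P_\sigma$ is the permutation matrix of $\sigma\in S_n$ with $P_\sigma P_\tau=P_{\sigma\tau}$, and $I$ is the $n\times n$ identity matrix. A derangement is a permutation with no fixed points. $G$ is the group of order $2(n!)^2$ acting on $n\times n$ matrices by the maps $M\mapsto P_\alpha M P_\beta^{ -1}$ and $M\mapsto P_\alpha M^T P_\beta^{ -1}$ for $\alpha,\beta\in S_n$ (generated by row permutations, column permutations and transpose). -}

module Defs where

open import Level using (0ℓ)
open import Data.Nat.Base using (ℕ; zero; suc; _+_; _*_; _^_; _/_; _!)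
open import Data.Nat.Properties using (m*n≢0; m^n≢0; _!≢0)
open import Data.Bool.Base using (Bool; true; false; if_then_else_)
open import Data.Fin.Base using (Fin)
import Data.Fin.Base as Fin
open import Data.Fin.Properties using (_≟_)
open import Data.Fin.Permutation using (Permutation′; _⟨$⟩ʳ_; flip)
open import Data.Product.Base using (Σ; ∃; _×_; _,_; proj₁)
open import Relation.Nullary.Decidable using (⌊_⌋)
open import Relation.Nullary.Negation using (¬_)
open import Relation.Binary.PropositionalEquality using (_≡_; refl; sym; trans; cong)
open import Relation.Binary.Bundles using (Setoid)
open import Function.Bundles using (Inverse)
import Relation.Binary.PropositionalEquality as ≡

Matrix : ℕ → Set
Matrix n = Fin n → Fin n → ℕ

_≈ᴹ_ : ∀ {n} → Matrix n → Matrix n → Set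
M ≈ᴹ N = ∀ i j → M i j ≡ N i j

∑ : ∀ {n} → (Fin n → ℕ) → ℕ
∑ {zero}  f = 0
∑ {suc n} f = f Fin.zero + ∑ (λ i → f (Fin.suc i))

_+ᴹ_ : ∀ {n} → Matrix n → Matrix n → Matrix n
(M +ᴹ N) i j = M i j + N i j

_*ᴹ_ : ∀ {n} → Matrix n → Matrix n → Matrix n
(M *ᴹ N) i j = ∑ (λ k → M i k * N k j)

_ᵀ : ∀ {n} → Matrix n → Matrix n
(M ᵀ) i j = M j i

δ : ∀ {n} → Fin n → Fin n → ℕ
δ i j = if ⌊ i ≟ j ⌋ then 1 else 0

I : ∀ {n} → Matrix n
I i j = δ i j

-- permutation matrix: column j has its 1 in row σ(j), so P σ e_j = e_{σ j}
-- and P σ *ᴹ P τ = P (σ ∘ τ) (i.e. P_σ P_τ = P_{στ}).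
P : ∀ {n} → Permutation′ n → Matrix n
P σ i j = δ i (σ ⟨$⟩ʳ j)

_≈ₚ_ : ∀ {n} → Permutation′ n → Permutation′ n → Set
σ ≈ₚ τ = ∀ i → σ ⟨$⟩ʳ i ≡ τ ⟨$⟩ʳ i

Derangement : ∀ {n} → Permutation′ n → Set
Derangement σ = ∀ i → ¬ (σ ⟨$⟩ʳ i ≡ i)

Involution : ∀ {n} → Permutation′ n → Set
Involution σ = ∀ i → σ ⟨$⟩ʳ (σ ⟨$⟩ʳ i) ≡ i

-- Elements of G (order 2(n!)^2): (t, α, β), with t = false meaning
-- M ↦ P_α M P_β⁻¹ and t = true meaning M ↦ P_α Mᵀ P_β⁻¹.
-- (P_β⁻¹ is the permutation matrix of the inverse permutation, flip β.)
G : ℕ → Set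
G n = Bool × Permutation′ n × Permutation′ n

_≈G_ : ∀ {n} → G n → G n → Set
(t , α , β) ≈G (t' , α' , β') = t ≡ t' × α ≈ₚ α' × β ≈ₚ β'

act : ∀ {n} → G n → Matrix n → Matrix n
act (false , α , β) M = (P α *ᴹ M) *ᴹ P (flip β)
act (true  , α , β) M = (P α *ᴹ (M ᵀ)) *ᴹ P (flip β)

Stabilizer : ∀ {n} → Matrix n → Setoid 0ℓ 0ℓ
Stabilizer {n} M = record
  { Carrier = Σ (G n) (λ g → act g M ≈ᴹ M)
  ; _≈_ = λ x y → proj₁ x ≈G proj₁ y
  ; isEquivalence = record
    { refl = λ { {(t , α , β) , _} → refl , (λ _ → refl) , (λ _ → refl) }
    ; sym = λ { (p , q , r) → sym p , (λ i → sym (q i)) , (λ i → sym (r i)) }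
    ; trans = λ { (p , q , r) (p' , q' , r') →
        trans p p' , (λ i → trans (q i) (q' i)) , (λ i → trans (r i) (r' i)) }
    }
  }

Orbit : ∀ {n} → Matrix n → Setoid 0ℓ 0ℓ
Orbit {n} M = record
  { Carrier = Σ (Matrix n) (λ N → ∃ λ (g : G n) → act g M ≈ᴹ N)
  ; _≈_ = λ x y → proj₁ x ≈ᴹ proj₁ y
  ; isEquivalence = record
    { refl = λ _ _ → refl
    ; sym = λ p i j → sym (p i j)
    ; trans = λ p q i j → trans (p i j) (q i j)
    }
  }

HasSize : Setoid 0ℓ 0ℓ → ℕ → Set
HasSize S k = Inverse (≡.setoid (Fin k)) S

-- (n!)^2 / (m! 2^n)  (exact division in ℕ)
orbitSize : ℕ → ℕ → ℕ
orbitSize m n = ((n ! * n !) / (m ! * 2 ^ n))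
  {{m*n≢0 (m !) (2 ^ n) {{m !≢0}} {{m^n≢0 2 n}}}}

-- Pair up the points of Fin n into the m orbits {i, σ i} of σ.  In these coordinates
-- I + P σ is block diagonal with m all-ones 2 × 2 blocks.  It is symmetric, so the
-- transpose flag of G is free, and a pair (α, β) of row and column permutations fixes it
-- iff M (α a) (β b) = M a b; this forces α and β to permute the blocks by one common
-- π ∈ Sₘ, while each may independently swap the two points inside every block.  Hence the
-- stabilizer has 2 · m! · 2ᵐ · 2ᵐ = m! 2ⁿ⁺¹ elements, and orbit–stabilizer in the group G of
-- order 2 (n!)² gives the orbit size.

module Submission where

open import Defs
open import Level using (0ℓ)
open import Data.Bool.Base using (Bool; true; false; not; _xor_)
open import Data.Bool.Properties
  using (not-involutive; not-¬; ¬-not; xor-assoc; xor-same; xor-identityʳ)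
import Data.Bool.Properties as Bool
open import Data.Fin.Base using (Fin; zero; suc; punchIn; punchOut)
open import Data.Fin.Properties using (_≟_; any?; all?; suc-injective; punchOut-cong; *↔×; 2↔Bool)
open import Data.Fin.Permutation
  using ( Permutation′; permutation; _⟨$⟩ʳ_; _⟨$⟩ˡ_; flip; _∘ₚ_; ↔⇒≡
        ; insert; remove; insert-remove; remove-insert; insert-punchIn )
import Data.Fin.Permutation as Perm
open import Data.Nat.Base using (ℕ; zero; suc; _+_; _*_; _^_; _!; _/_; NonZero)
open import Data.Nat.DivMod using (m*n/n≡m)
import Data.Nat.Properties as ℕ
open import Data.Product.Base using (_×_; _,_; proj₁; proj₂; ∃)
open import Data.Product.Function.NonDependent.Setoid using (_×-inverse_)
open import Data.Product.Relation.Binary.Pointwise.NonDependent using (_×ₛ_; Pointwise-≡↔≡)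
open import Data.Sum.Base using (_⊎_; inj₁; inj₂)
open import Function.Base using (id; _∘_)
open import Function.Bundles using (Inverse; Injection; _↔_; mk↔ₛ′)
open import Function.Construct.Identity using (↔-id)
import Function.Construct.Composition as Compose
import Function.Construct.Symmetry as Symmetry
import Function.Consequences.Setoid as Consequences
open import Function.Definitions using (Congruent; StrictlyInverseˡ; StrictlyInverseʳ)
open import Function.Properties.Inverse using (↔⇒↣)
open import Relation.Binary.Bundles using (Setoid)
open import Relation.Binary.Definitions using (Decidable)
open import Relation.Binary.PropositionalEquality
  using (_≡_; refl; sym; trans; cong; cong₂; subst; setoid; _→-setoid_; module ≡-Reasoning)
import Relation.Binary.Reasoning.Setoid as SetoidReasoning
open import Relation.Nullary.Decidable using (yes; no; does; _⊎-dec_; dec-true; dec-false)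
open import Relation.Nullary.Negation using (¬_; contradiction)
open import Algebra.Properties.CommutativeSemigroup ℕ.*-commutativeSemigroup
  using () renaming (x∙yz≈y∙xz to *-left-comm)

private
  variable
    S T : Setoid 0ℓ 0ℓ

module _ {S T : Setoid 0ℓ 0ℓ} where
  open Setoid S using () renaming (Carrier to A; _≈_ to _≈₁_)
  open Setoid T using () renaming (Carrier to B; _≈_ to _≈₂_)

  mk↔ₛ : (to : A → B) (from : B → A) →
         Congruent _≈₁_ _≈₂_ to → Congruent _≈₂_ _≈₁_ from →
         StrictlyInverseˡ _≈₂_ to from → StrictlyInverseʳ _≈₁_ to from →
         Inverse S T
  mk↔ₛ to from to-cong from-cong invˡ invʳ = record
    { to = to ; from = from ; to-cong = to-cong ; from-cong = from-cong
    ; inverse = Consequences.strictlyInverseˡ⇒inverseˡ S T to-cong invˡ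
              , Consequences.strictlyInverseʳ⇒inverseʳ S T from-cong invʳ
    }

infixr 9 _⨾_
_⨾_ : {R : Setoid 0ℓ 0ℓ} → Inverse R S → Inverse S T → Inverse R T
_⨾_ = Compose.inverse

hasSize-cong : ∀ {a b} → a ≡ b → HasSize S a → HasSize S b
hasSize-cong refl A = A

×-hasSize : ∀ {a b} → HasSize S a → HasSize T b → HasSize (S ×ₛ T) (a * b)
×-hasSize {a = a} {b = b} A B = *↔× {a} {b} ⨾ Symmetry.inverse Pointwise-≡↔≡ ⨾ (A ×-inverse B)

hasSize-unique : ∀ {a b} → HasSize S a → HasSize S b → a ≡ b
hasSize-unique A B = ↔⇒≡ (A ⨾ Symmetry.inverse B)

↔-injective : ∀ {A B : Set} (F : A ↔ B) {x y} → Inverse.to F x ≡ Inverse.to F y → x ≡ y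
↔-injective F = Injection.injective (↔⇒↣ F)

Bool^ : ℕ → Setoid 0ℓ 0ℓ
Bool^ m = Fin m →-setoid Bool

Bool^-suc↔ : ∀ m → Inverse (setoid Bool ×ₛ Bool^ m) (Bool^ (suc m))
Bool^-suc↔ m = mk↔ₛ cons uncons cons-cong (λ p → p zero , λ i → p (suc i))
    (λ { f zero → refl ; f (suc i) → refl }) (λ _ → refl , λ _ → refl)
  where
  cons : Bool × (Fin m → Bool) → Fin (suc m) → Bool
  cons (b , f) zero    = b
  cons (b , f) (suc i) = f i
  uncons : (Fin (suc m) → Bool) → Bool × (Fin m → Bool)
  uncons f = f zero , λ i → f (suc i)
  cons-cong : ∀ {x y} → Setoid._≈_ (setoid Bool ×ₛ Bool^ m) x y → ∀ i → cons x i ≡ cons y i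
  cons-cong (p , q) zero    = p
  cons-cong (p , q) (suc i) = q i

Bool^-hasSize : ∀ m → HasSize (Bool^ m) (2 ^ m)
Bool^-hasSize zero    = mk↔ₛ (λ _ ()) (λ _ → zero) (λ _ ()) (λ _ → refl) (λ _ ()) λ { zero → refl }
Bool^-hasSize (suc m) = ×-hasSize 2↔Bool (Bool^-hasSize m) ⨾ Bool^-suc↔ m

Perms : ℕ → Setoid 0ℓ 0ℓ
Perms n = record
  { Carrier = Permutation′ n
  ; _≈_ = _≈ₚ_
  ; isEquivalence = record
    { refl = λ _ → refl ; sym = λ p i → sym (p i) ; trans = λ p q i → trans (p i) (q i) }
  }

Perms-suc↔ : ∀ n → Inverse (setoid (Fin (suc n)) ×ₛ Perms n) (Perms (suc n))
Perms-suc↔ n = mk↔ₛ (λ (j , π) → insert zero j π) (λ π → π ⟨$⟩ʳ zero , remove zero π)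
    insert-cong (λ {π} {ρ} → remove-cong {π} {ρ}) (λ π → insert-remove zero π) (λ (j , π) → refl , remove-insert zero j π)
  where
  insert-cong : ∀ {x y} → Setoid._≈_ (setoid (Fin (suc n)) ×ₛ Perms n) x y →
                insert zero (proj₁ x) (proj₂ x) ≈ₚ insert zero (proj₁ y) (proj₂ y)
  insert-cong (refl , p) zero    = refl
  insert-cong {j , π} {j , ρ} (refl , p) (suc k) = begin
    insert zero j π ⟨$⟩ʳ suc k ≡⟨ insert-punchIn zero j π k ⟩
    punchIn j (π ⟨$⟩ʳ k)       ≡⟨ cong (punchIn j) (p k) ⟩
    punchIn j (ρ ⟨$⟩ʳ k)       ≡⟨ insert-punchIn zero j ρ k ⟨
    insert zero j ρ ⟨$⟩ʳ suc k ∎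
    where open ≡-Reasoning
  remove-cong : ∀ {π ρ : Permutation′ (suc n)} → π ≈ₚ ρ → (π ⟨$⟩ʳ zero ≡ ρ ⟨$⟩ʳ zero) × remove zero π ≈ₚ remove zero ρ
  remove-cong p = p zero , λ k → punchOut-cong₂ (p zero) (p (suc k))
    where
    punchOut-cong₂ : ∀ {i i′ j j′ : Fin (suc n)} {i≢j : ¬ i ≡ j} {i′≢j′ : ¬ i′ ≡ j′} →
                     i ≡ i′ → j ≡ j′ → punchOut i≢j ≡ punchOut i′≢j′
    punchOut-cong₂ {i} refl = punchOut-cong i

Perms-hasSize : ∀ n → HasSize (Perms n) (n !)
Perms-hasSize zero    = mk↔ₛ (λ _ → Perm.id) (λ _ → zero) (λ _ ()) (λ _ → refl) (λ _ ()) λ { zero → refl }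
Perms-hasSize (suc n) = ×-hasSize (↔-id _) (Perms-hasSize n) ⨾ Perms-suc↔ n

module _ {n : ℕ} where

  ≈ₚ-flip : (α β : Permutation′ n) → α ≈ₚ β → flip α ≈ₚ flip β
  ≈ₚ-flip α β α≈β i = begin
    α ⟨$⟩ˡ i                        ≡⟨ Perm.inverseˡ β ⟨
    β ⟨$⟩ˡ (β ⟨$⟩ʳ (α ⟨$⟩ˡ i))      ≡⟨ cong (β ⟨$⟩ˡ_) (α≈β (α ⟨$⟩ˡ i)) ⟨
    β ⟨$⟩ˡ (α ⟨$⟩ʳ (α ⟨$⟩ˡ i))      ≡⟨ cong (β ⟨$⟩ˡ_) (Perm.inverseʳ α) ⟩
    β ⟨$⟩ˡ i                        ∎
    where open ≡-Reasoning

  ∘ₚ-cong : (α α′ β β′ : Permutation′ n) → α ≈ₚ α′ → β ≈ₚ β′ → (α ∘ₚ β) ≈ₚ (α′ ∘ₚ β′)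
  ∘ₚ-cong α α′ β β′ α≈α′ β≈β′ i = trans (cong (β ⟨$⟩ʳ_) (α≈α′ i)) (β≈β′ _)

module _ (S : Setoid 0ℓ 0ℓ) (_≈?_ : Decidable (Setoid._≈_ S)) where
  open Setoid S renaming (Carrier to A; refl to ≈-refl; sym to ≈-sym; trans to ≈-trans)

  record Transversal {N : ℕ} (f : Fin N → A) : Set where
    field
      size : ℕ
      pick : Fin size → Fin N
      pick-injective : ∀ i j → f (pick i) ≈ f (pick j) → i ≡ j
      pick-surjective : ∀ k → ∃ λ i → f (pick i) ≈ f k

  transversal : ∀ N (f : Fin N → A) → Transversal f
  transversal zero    f = record { size = 0 ; pick = λ () ; pick-injective = λ () ; pick-surjective = λ () }
  transversal (suc N) f = extend (transversal N (f ∘ suc))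
    where
    extend : Transversal (f ∘ suc) → Transversal f
    extend record { size = c ; pick = h ; pick-injective = inj ; pick-surjective = sur }
      with any? (λ i → f (suc (h i)) ≈? f zero)
    ... | yes (i₀ , fhi₀≈f0) = record
      { size = c ; pick = suc ∘ h ; pick-injective = inj
      ; pick-surjective = λ { zero → i₀ , fhi₀≈f0 ; (suc k) → sur k } }
    ... | no f0-new = record
      { size = suc c ; pick = h′ ; pick-injective = inj′
      ; pick-surjective = λ { zero → zero , ≈-refl ; (suc k) → suc (proj₁ (sur k)) , proj₂ (sur k) } }
      where
      h′ : Fin (suc c) → Fin (suc N)
      h′ zero    = zero
      h′ (suc i) = suc (h i)
      inj′ : ∀ i j → f (h′ i) ≈ f (h′ j) → i ≡ j
      inj′ zero    zero    _ = refl
      inj′ zero    (suc j) e = contradiction (j , ≈-sym e) f0-new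
      inj′ (suc i) zero    e = contradiction (i , e) f0-new
      inj′ (suc i) (suc j) e = cong suc (inj i j e)

  image-hasSize : ∀ {N} (f : Fin N → A) → (∀ x → ∃ λ k → f k ≈ x) → ∃ λ c → HasSize S c
  image-hasSize {N} f f-surjective = size , mk↔ₛ g g⁻¹ (λ { refl → ≈-refl }) g⁻¹-cong g-g⁻¹ g⁻¹-g
    where
    open Transversal (transversal N f)
    g : Fin size → A
    g = f ∘ pick
    g-surjective : ∀ x → ∃ λ i → g i ≈ x
    g-surjective x = let k , fk≈x = f-surjective x ; i , gi≈fk = pick-surjective k
                     in i , ≈-trans gi≈fk fk≈x
    g⁻¹ : A → Fin size
    g⁻¹ x = proj₁ (g-surjective x)
    g-g⁻¹ : ∀ x → g (g⁻¹ x) ≈ x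
    g-g⁻¹ x = proj₂ (g-surjective x)
    g⁻¹-cong : ∀ {x y} → x ≈ y → g⁻¹ x ≡ g⁻¹ y
    g⁻¹-cong {x} {y} x≈y = pick-injective _ _ (≈-trans (g-g⁻¹ x) (≈-trans x≈y (≈-sym (g-g⁻¹ y))))
    g⁻¹-g : ∀ i → g⁻¹ (g i) ≡ i
    g⁻¹-g i = pick-injective _ _ (g-g⁻¹ (g i))

δ-≡ : ∀ {n} {i j : Fin n} → i ≡ j → δ i j ≡ 1
δ-≡ {i = i} {j} i≡j with i ≟ j
... | yes _   = refl
... | no  i≢j = contradiction i≡j i≢j

δ-≢ : ∀ {n} {i j : Fin n} → ¬ i ≡ j → δ i j ≡ 0
δ-≢ {i = i} {j} i≢j with i ≟ j
... | yes i≡j = contradiction i≡j i≢j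
... | no  _   = refl

δ-cong-⇔ : ∀ {m n} {i j : Fin m} {k l : Fin n} → (i ≡ j → k ≡ l) → (k ≡ l → i ≡ j) → δ i j ≡ δ k l
δ-cong-⇔ {i = i} {j} to from with i ≟ j
... | yes i≡j = sym (δ-≡ (to i≡j))
... | no  i≢j = sym (δ-≢ (i≢j ∘ from))

δ≡1⇒≡ : ∀ {n} {i j : Fin n} → δ i j ≡ 1 → i ≡ j
δ≡1⇒≡ {i = i} {j} δij≡1 with i ≟ j
... | yes i≡j = i≡j
... | no  _   = contradiction δij≡1 λ ()

δ-sym : ∀ {n} (i j : Fin n) → δ i j ≡ δ j i
δ-sym i j = δ-cong-⇔ sym sym

∑-cong : ∀ {n} {f g : Fin n → ℕ} → (∀ k → f k ≡ g k) → ∑ f ≡ ∑ g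
∑-cong {zero}  f≗g = refl
∑-cong {suc n} f≗g = cong₂ _+_ (f≗g zero) (∑-cong (f≗g ∘ suc))

∑-zero : ∀ {n} {f : Fin n → ℕ} → (∀ k → f k ≡ 0) → ∑ f ≡ 0
∑-zero {zero}  f≗0 = refl
∑-zero {suc n} f≗0 = cong₂ _+_ (f≗0 zero) (∑-zero (f≗0 ∘ suc))

∑-δˡ : ∀ {n} (i : Fin n) (f : Fin n → ℕ) → ∑ (λ k → δ i k * f k) ≡ f i
∑-δˡ {suc n} zero f = begin
  δ {suc n} zero zero * f zero + ∑ (λ k → δ zero (suc k) * f (suc k))
    ≡⟨ cong₂ _+_ (cong (_* f zero) (δ-≡ {suc n} {zero} refl))
                 (∑-zero λ k → cong (_* f (suc k)) (δ-≢ {i = zero} {suc k} λ ())) ⟩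
  1 * f zero + 0  ≡⟨ ℕ.+-identityʳ _ ⟩
  1 * f zero      ≡⟨ ℕ.*-identityˡ _ ⟩
  f zero          ∎
  where open ≡-Reasoning
∑-δˡ {suc n} (suc i) f = begin
  δ (suc i) zero * f zero + ∑ (λ k → δ (suc i) (suc k) * f (suc k))
    ≡⟨ cong₂ _+_ (cong (_* f zero) (δ-≢ {i = suc i} {zero} λ ()))
                 (∑-cong λ k → cong (_* f (suc k)) (δ-cong-⇔ {i = suc i} {suc k} suc-injective (cong suc))) ⟩
  ∑ (λ k → δ i k * f (suc k))  ≡⟨ ∑-δˡ i (f ∘ suc) ⟩
  f (suc i)                    ∎
  where open ≡-Reasoning

∑-δʳ : ∀ {n} (i : Fin n) (f : Fin n → ℕ) → ∑ (λ k → f k * δ k i) ≡ f i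
∑-δʳ i f = trans (∑-cong λ k → trans (ℕ.*-comm (f k) (δ k i)) (cong (_* f k) (δ-sym k i))) (∑-δˡ i f)

P-*ᴹ : ∀ {n} (α : Permutation′ n) (N : Matrix n) → (P α *ᴹ N) ≈ᴹ (λ i j → N (α ⟨$⟩ˡ i) j)
P-*ᴹ α N i j = trans (∑-cong λ k → cong (_* N k j) (δ-cong-⇔ {i = i} {α ⟨$⟩ʳ k} to from))
                     (∑-δˡ (α ⟨$⟩ˡ i) (λ k → N k j))
  where
  to : ∀ {k} → i ≡ α ⟨$⟩ʳ k → α ⟨$⟩ˡ i ≡ k
  to refl = Perm.inverseˡ α
  from : ∀ {k} → α ⟨$⟩ˡ i ≡ k → i ≡ α ⟨$⟩ʳ k
  from refl = sym (Perm.inverseʳ α)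

*ᴹ-P-flip : ∀ {n} (β : Permutation′ n) (N : Matrix n) → (N *ᴹ P (flip β)) ≈ᴹ (λ i j → N i (β ⟨$⟩ˡ j))
*ᴹ-P-flip β N i j = ∑-δʳ (β ⟨$⟩ˡ j) (N i)

act′ : ∀ {n} → G n → Matrix n → Matrix n
act′ (false , α , β) N i j = N (α ⟨$⟩ˡ i) (β ⟨$⟩ˡ j)
act′ (true  , α , β) N i j = N (β ⟨$⟩ˡ j) (α ⟨$⟩ˡ i)

act≈act′ : ∀ {n} (g : G n) (N : Matrix n) → act g N ≈ᴹ act′ g N
act≈act′ (false , α , β) N i j =
  trans (∑-cong λ k → cong (_* P (flip β) k j) (P-*ᴹ α N i k)) (*ᴹ-P-flip β (λ i k → N (α ⟨$⟩ˡ i) k) i j)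
act≈act′ (true  , α , β) N i j =
  trans (∑-cong λ k → cong (_* P (flip β) k j) (P-*ᴹ α (N ᵀ) i k)) (*ᴹ-P-flip β (λ i k → N k (α ⟨$⟩ˡ i)) i j)

Matrixₛ : ℕ → Setoid 0ℓ 0ℓ
Matrixₛ n = record
  { Carrier = Matrix n
  ; _≈_ = _≈ᴹ_
  ; isEquivalence = record
    { refl = λ _ _ → refl
    ; sym = λ M≈N i j → sym (M≈N i j)
    ; trans = λ M≈N N≈O i j → trans (M≈N i j) (N≈O i j)
    }
  }

_≟ᴹ_ : ∀ {n} → Decidable (_≈ᴹ_ {n})
M ≟ᴹ N = all? λ i → all? λ j → M i j ℕ.≟ N i j

Gₛ : ℕ → Setoid 0ℓ 0ℓ
Gₛ n = setoid Bool ×ₛ (Perms n ×ₛ Perms n)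

G-hasSize : ∀ n → HasSize (Gₛ n) (2 * (n ! * n !))
G-hasSize n = ×-hasSize 2↔Bool (×-hasSize (Perms-hasSize n) (Perms-hasSize n))

module _ {n : ℕ} where

  infixl 21 _·_
  _·_ : G n → G n → G n
  (false , α , β) · (t , α′ , β′) = t , α′ ∘ₚ α , β′ ∘ₚ β
  (true  , α , β) · (t , α′ , β′) = not t , β′ ∘ₚ α , α′ ∘ₚ β

  infix 22 _⁻¹
  _⁻¹ : G n → G n
  (false , α , β) ⁻¹ = false , flip α , flip β
  (true  , α , β) ⁻¹ = true  , flip β , flip α

  ·-cong : {g g′ h h′ : G n} → g ≈G g′ → h ≈G h′ → g · h ≈G g′ · h′
  ·-cong {false , α , β} {false , α₁ , β₁} {_ , γ , ε} {_ , γ₁ , ε₁} (refl , α≈ , β≈) (refl , γ≈ , ε≈) =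
    refl , ∘ₚ-cong γ γ₁ α α₁ γ≈ α≈ , ∘ₚ-cong ε ε₁ β β₁ ε≈ β≈
  ·-cong {true  , α , β} {true  , α₁ , β₁} {_ , γ , ε} {_ , γ₁ , ε₁} (refl , α≈ , β≈) (refl , γ≈ , ε≈) =
    refl , ∘ₚ-cong ε ε₁ α α₁ ε≈ α≈ , ∘ₚ-cong γ γ₁ β β₁ γ≈ β≈

  ⁻¹-cong : {g h : G n} → g ≈G h → g ⁻¹ ≈G h ⁻¹
  ⁻¹-cong {false , α , β} {false , α′ , β′} (refl , α≈ , β≈) = refl , ≈ₚ-flip α α′ α≈ , ≈ₚ-flip β β′ β≈
  ⁻¹-cong {true  , α , β} {true  , α′ , β′} (refl , α≈ , β≈) = refl , ≈ₚ-flip β β′ β≈ , ≈ₚ-flip α α′ α≈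

  ·-inverseˡ-cancel : (g h : G n) → g ⁻¹ · (g · h) ≈G h
  ·-inverseˡ-cancel (false , α , β) (t , _) = refl , (λ _ → Perm.inverseˡ α) , (λ _ → Perm.inverseˡ β)
  ·-inverseˡ-cancel (true  , α , β) (t , _) = not-involutive t , (λ _ → Perm.inverseˡ β) , (λ _ → Perm.inverseˡ α)

  ·-inverseʳ-cancel : (g h : G n) → g · (g ⁻¹ · h) ≈G h
  ·-inverseʳ-cancel (false , α , β) (t , _) = refl , (λ _ → Perm.inverseʳ α) , (λ _ → Perm.inverseʳ β)
  ·-inverseʳ-cancel (true  , α , β) (t , _) = not-involutive t , (λ _ → Perm.inverseʳ α) , (λ _ → Perm.inverseʳ β)

  act′-· : (g h : G n) (N : Matrix n) → act′ (g · h) N ≈ᴹ act′ g (act′ h N)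
  act′-· (false , _) (false , _) N i j = refl
  act′-· (false , _) (true  , _) N i j = refl
  act′-· (true  , _) (false , _) N i j = refl
  act′-· (true  , _) (true  , _) N i j = refl

  act′-⁻¹ : (g : G n) (N : Matrix n) → act′ (g ⁻¹) (act′ g N) ≈ᴹ N
  act′-⁻¹ (false , α , β) N i j = cong₂ N (Perm.inverseˡ α) (Perm.inverseˡ β)
  act′-⁻¹ (true  , α , β) N i j = cong₂ N (Perm.inverseˡ β) (Perm.inverseˡ α)

  act′-congʳ : (g : G n) {N N′ : Matrix n} → N ≈ᴹ N′ → act′ g N ≈ᴹ act′ g N′
  act′-congʳ (false , α , β) N≈N′ i j = N≈N′ _ _
  act′-congʳ (true  , α , β) N≈N′ i j = N≈N′ _ _

  act′-congˡ : {g h : G n} (N : Matrix n) → g ≈G h → act′ g N ≈ᴹ act′ h N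
  act′-congˡ {false , α , β} {false , α′ , β′} N (refl , α≈ , β≈) i j =
    cong₂ N (≈ₚ-flip α α′ α≈ i) (≈ₚ-flip β β′ β≈ j)
  act′-congˡ {true  , α , β} {true  , α′ , β′} N (refl , α≈ , β≈) i j =
    cong₂ N (≈ₚ-flip β β′ β≈ j) (≈ₚ-flip α α′ α≈ i)

module _ {n : ℕ} where
  open SetoidReasoning (Matrixₛ n)

  act-congˡ : {g h : G n} (N : Matrix n) → g ≈G h → act g N ≈ᴹ act h N
  act-congˡ {g} {h} N g≈h = begin
    act g N   ≈⟨ act≈act′ g N ⟩
    act′ g N  ≈⟨ act′-congˡ N g≈h ⟩
    act′ h N  ≈⟨ act≈act′ h N ⟨
    act h N   ∎

  act-congʳ : (g : G n) {N N′ : Matrix n} → N ≈ᴹ N′ → act g N ≈ᴹ act g N′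
  act-congʳ g {N} {N′} N≈N′ = begin
    act g N   ≈⟨ act≈act′ g N ⟩
    act′ g N  ≈⟨ act′-congʳ g N≈N′ ⟩
    act′ g N′ ≈⟨ act≈act′ g N′ ⟨
    act g N′  ∎

  act-· : (g h : G n) (N : Matrix n) → act (g · h) N ≈ᴹ act g (act h N)
  act-· g h N = begin
    act (g · h) N        ≈⟨ act≈act′ (g · h) N ⟩
    act′ (g · h) N       ≈⟨ act′-· g h N ⟩
    act′ g (act′ h N)    ≈⟨ act′-congʳ g (act≈act′ h N) ⟨
    act′ g (act h N)     ≈⟨ act≈act′ g (act h N) ⟨
    act g (act h N)      ∎

  act-⁻¹ : (g : G n) (N : Matrix n) → act (g ⁻¹) (act g N) ≈ᴹ N
  act-⁻¹ g N = begin
    act (g ⁻¹) (act g N)    ≈⟨ act≈act′ (g ⁻¹) (act g N) ⟩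
    act′ (g ⁻¹) (act g N)   ≈⟨ act′-congʳ (g ⁻¹) (act≈act′ g N) ⟩
    act′ (g ⁻¹) (act′ g N)  ≈⟨ act′-⁻¹ g N ⟩
    N                       ∎

module OrbitStabilizer {n : ℕ} (M : Matrix n) where
  open Setoid (Matrixₛ n) using () renaming (sym to ≈ᴹ-sym; trans to ≈ᴹ-trans)
  open Setoid (Gₛ n) using () renaming (reflexive to ≈G-reflexive)
  open Setoid (Orbit M) using () renaming (Carrier to OrbitPoint; _≈_ to _≈ₒ_)
  module GS = Inverse (G-hasSize n)

  orbit-point : G n → OrbitPoint
  orbit-point g = act g M , g , λ _ _ → refl

  orbit-hasSize : ∃ λ c → HasSize (Orbit M) c
  orbit-hasSize = image-hasSize (Orbit M) (λ x y → proj₁ x ≟ᴹ proj₁ y) (orbit-point ∘ GS.to) covers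
    where
    covers : ∀ x → ∃ λ k → orbit-point (GS.to k) ≈ₒ x
    covers (N , g , gM≈N) = GS.from g , ≈ᴹ-trans (act-congˡ M (GS.strictlyInverseˡ g)) gM≈N

  module _ {c : ℕ} (orbit : HasSize (Orbit M) c) where
    open Inverse orbit using (from-cong; strictlyInverseˡ) renaming (to to point; from to index)

    rep : OrbitPoint → G n
    rep x = proj₁ (proj₂ (point (index x)))

    rep-act : ∀ x → act (rep x) M ≈ᴹ proj₁ x
    rep-act x = ≈ᴹ-trans (proj₂ (proj₂ (point (index x)))) (strictlyInverseˡ x)

    rep-cong : ∀ {x y} → x ≈ₒ y → rep x ≡ rep y
    rep-cong x≈y = cong (λ k → proj₁ (proj₂ (point k))) (from-cong x≈y)

    G↔Orbit×Stabilizer : Inverse (Gₛ n) (Orbit M ×ₛ Stabilizer M)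
    G↔Orbit×Stabilizer = mk↔ₛ to from to-cong (λ {y} {z} → from-cong′ {y} {z}) to-from from-to
      where
      open SetoidReasoning (Matrixₛ n)
      to : G n → OrbitPoint × Setoid.Carrier (Stabilizer M)
      to g = orbit-point g , rep (orbit-point g) ⁻¹ · g , stabilizes
        where
        r : G n
        r = rep (orbit-point g)
        stabilizes : act (r ⁻¹ · g) M ≈ᴹ M
        stabilizes = begin
          act (r ⁻¹ · g) M        ≈⟨ act-· (r ⁻¹) g M ⟩
          act (r ⁻¹) (act g M)    ≈⟨ act-congʳ (r ⁻¹) (rep-act (orbit-point g)) ⟨
          act (r ⁻¹) (act r M)    ≈⟨ act-⁻¹ r M ⟩
          M                       ∎
      from : OrbitPoint × Setoid.Carrier (Stabilizer M) → G n
      from (x , h , _) = rep x · h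
      to-cong : ∀ {g h} → g ≈G h → Setoid._≈_ (Orbit M ×ₛ Stabilizer M) (to g) (to h)
      to-cong g≈h = act-congˡ M g≈h , ·-cong (⁻¹-cong (≈G-reflexive (rep-cong (act-congˡ M g≈h)))) g≈h
      from-cong′ : ∀ {y z} → Setoid._≈_ (Orbit M ×ₛ Stabilizer M) y z → from y ≈G from z
      from-cong′ (x≈x′ , h≈h′) = ·-cong (≈G-reflexive (rep-cong x≈x′)) h≈h′
      to-from : ∀ y → Setoid._≈_ (Orbit M ×ₛ Stabilizer M) (to (from y)) y
      to-from (x , h , hM≈M) = orbit-point-≈ , rep⁻¹-cancel
        where
        orbit-point-≈ : act (rep x · h) M ≈ᴹ proj₁ x
        orbit-point-≈ = begin
          act (rep x · h) M        ≈⟨ act-· (rep x) h M ⟩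
          act (rep x) (act h M)    ≈⟨ act-congʳ (rep x) hM≈M ⟩
          act (rep x) M            ≈⟨ rep-act x ⟩
          proj₁ x                  ∎
        same-rep : rep (orbit-point (rep x · h)) ≡ rep x
        same-rep = rep-cong {orbit-point (rep x · h)} {x} orbit-point-≈
        rep⁻¹-cancel : rep (orbit-point (rep x · h)) ⁻¹ · (rep x · h) ≈G h
        rep⁻¹-cancel = subst (λ r → r ⁻¹ · (rep x · h) ≈G h) (sym same-rep) (·-inverseˡ-cancel (rep x) h)
      from-to : ∀ g → from (to g) ≈G g
      from-to g = ·-inverseʳ-cancel (rep (orbit-point g)) g

  orbit-stabilizer : ∀ {s} → HasSize (Stabilizer M) s → ∃ λ c → HasSize (Orbit M) c × c * s ≡ 2 * (n ! * n !)
  orbit-stabilizer stabilizer = c , orbit ,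
    hasSize-unique (×-hasSize orbit stabilizer) (G-hasSize n ⨾ G↔Orbit×Stabilizer orbit)
    where
    c : ℕ
    c = proj₁ orbit-hasSize
    orbit : HasSize (Orbit M) c
    orbit = proj₂ orbit-hasSize

module _ {n : ℕ} where

  Symmetric : Matrix n → Set
  Symmetric M = ∀ i j → M i j ≡ M j i

  P-symmetric : (σ : Permutation′ n) → Involution σ → Symmetric (P σ)
  P-symmetric σ invol i j = δ-cong-⇔ {i = i} {σ ⟨$⟩ʳ j} (σ-swap i j) (σ-swap j i)
    where
    σ-swap : ∀ i j → i ≡ σ ⟨$⟩ʳ j → j ≡ σ ⟨$⟩ʳ i
    σ-swap i j refl = sym (invol j)

  Invariant : Permutation′ n → Permutation′ n → Matrix n → Set
  Invariant α β M = ∀ i j → M (α ⟨$⟩ʳ i) (β ⟨$⟩ʳ j) ≡ M i j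

  module _ {M : Matrix n} (M-sym : Symmetric M) where

    act′-relabel : ∀ t α β i j → act′ (t , α , β) M (α ⟨$⟩ʳ i) (β ⟨$⟩ʳ j) ≡ M i j
    act′-relabel false α β i j = cong₂ M (Perm.inverseˡ α) (Perm.inverseˡ β)
    act′-relabel true  α β i j = trans (cong₂ M (Perm.inverseˡ β) (Perm.inverseˡ α)) (M-sym j i)

    stabilizes⇒invariant : ∀ t α β → act (t , α , β) M ≈ᴹ M → Invariant α β M
    stabilizes⇒invariant t α β gM≈M i j = begin
      M (α ⟨$⟩ʳ i) (β ⟨$⟩ʳ j)                  ≡⟨ gM≈M _ _ ⟨
      act (t , α , β) M (α ⟨$⟩ʳ i) (β ⟨$⟩ʳ j)  ≡⟨ act≈act′ (t , α , β) M _ _ ⟩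
      act′ (t , α , β) M (α ⟨$⟩ʳ i) (β ⟨$⟩ʳ j) ≡⟨ act′-relabel t α β i j ⟩
      M i j                                     ∎
      where open ≡-Reasoning

    invariant⇒stabilizes : ∀ t α β → Invariant α β M → act (t , α , β) M ≈ᴹ M
    invariant⇒stabilizes t α β inv i j = begin
      act (t , α , β) M i j                      ≡⟨ act≈act′ (t , α , β) M i j ⟩
      act′ (t , α , β) M i j                     ≡⟨ cong₂ (act′ (t , α , β) M) (Perm.inverseʳ α) (Perm.inverseʳ β) ⟨
      act′ (t , α , β) M (α ⟨$⟩ʳ i′) (β ⟨$⟩ʳ j′) ≡⟨ act′-relabel t α β i′ j′ ⟩
      M i′ j′                                    ≡⟨ inv i′ j′ ⟨
      M (α ⟨$⟩ʳ i′) (β ⟨$⟩ʳ j′)                  ≡⟨ cong₂ M (Perm.inverseʳ α) (Perm.inverseʳ β) ⟩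
      M i j                                      ∎
      where
      open ≡-Reasoning
      i′ j′ : Fin n
      i′ = α ⟨$⟩ˡ i
      j′ = β ⟨$⟩ˡ j

record Pairing {n : ℕ} (σ : Permutation′ n) : Set where
  field
    blocks : ℕ
    pairing : (Fin blocks × Bool) ↔ Fin n
    σ-pairing : ∀ k b → σ ⟨$⟩ʳ Inverse.to pairing (k , b) ≡ Inverse.to pairing (k , not b)

module _ {n : ℕ} (σ : Permutation′ n) (invol : Involution σ) where

  σ-orbits : Setoid 0ℓ 0ℓ
  σ-orbits = record
    { Carrier = Fin n
    ; _≈_ = λ i j → i ≡ j ⊎ σ ⟨$⟩ʳ i ≡ j
    ; isEquivalence = record
      { refl = inj₁ refl
      ; sym = λ { (inj₁ i≡j) → inj₁ (sym i≡j) ; (inj₂ refl) → inj₂ (invol _) }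
      ; trans = λ { (inj₁ refl) j∼k → j∼k
                  ; (inj₂ refl) (inj₁ refl) → inj₂ refl
                  ; (inj₂ refl) (inj₂ refl) → inj₁ (sym (invol _)) }
      }
    }

  σ-orbits? : Decidable (Setoid._≈_ σ-orbits)
  σ-orbits? i j = (i ≟ j) ⊎-dec (σ ⟨$⟩ʳ i ≟ j)

  pairing-of-fixedPointFree : Derangement σ → Pairing σ
  pairing-of-fixedPointFree der = record
    { blocks = c ; pairing = mk↔ₛ′ φ ψ φ-ψ ψ-φ ; σ-pairing = σ-φ }
    where
    orbits : ∃ λ c → HasSize σ-orbits c
    orbits = image-hasSize σ-orbits σ-orbits? id (λ i → i , inj₁ refl)
    c : ℕ
    c = proj₁ orbits
    open Inverse (proj₂ orbits) renaming (to to rep; from to orbit)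

    φ : Fin c × Bool → Fin n
    φ (k , false) = rep k
    φ (k , true)  = σ ⟨$⟩ʳ rep k

    -- the flag records whether i is the chosen representative of its σ-orbit or its partner
    ψ : Fin n → Fin c × Bool
    ψ i = orbit i , not (does (rep (orbit i) ≟ i))

    φ-ψ : ∀ i → φ (ψ i) ≡ i
    φ-ψ i with rep (orbit i) ≟ i | strictlyInverseˡ i
    ... | yes rep≡i | _           = rep≡i
    ... | no  rep≢i | inj₁ rep≡i  = contradiction rep≡i rep≢i
    ... | no  _     | inj₂ σrep≡i = σrep≡i

    ψ-φ : ∀ x → ψ (φ x) ≡ x
    ψ-φ (k , false) rewrite strictlyInverseʳ k | dec-true (rep k ≟ rep k) refl = refl
    ψ-φ (k , true)
      rewrite from-cong {σ ⟨$⟩ʳ rep k} {rep k} (inj₂ (invol (rep k))) | strictlyInverseʳ k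
            | dec-false (rep k ≟ σ ⟨$⟩ʳ rep k) (der (rep k) ∘ sym) = refl

    σ-φ : ∀ k b → σ ⟨$⟩ʳ φ (k , b) ≡ φ (k , not b)
    σ-φ k false = refl
    σ-φ k true  = invol (rep k)

xor-cancelʳ : ∀ b s → (b xor s) xor s ≡ b
xor-cancelʳ b s = trans (xor-assoc b s s) (trans (cong (b xor_) (xor-same s)) (xor-identityʳ b))

module _ {A B : Set} (F : A × Bool → B × Bool) (F-injective : ∀ {x y} → F x ≡ F y → x ≡ y) where

  pair-map-form : ∀ a → proj₁ (F (a , true)) ≡ proj₁ (F (a , false)) →
                  ∀ b → F (a , b) ≡ (proj₁ (F (a , false)) , b xor proj₂ (F (a , false)))
  pair-map-form a sameBlock false = refl
  pair-map-form a sameBlock true  = cong₂ _,_ sameBlock (¬-not λ sameSign →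
    contradiction (cong proj₂ (F-injective (cong₂ _,_ sameBlock sameSign))) λ ())

module PairedBlocks {n : ℕ} {σ : Permutation′ n} (invol : Involution σ) (paired : Pairing σ) where
  open Pairing paired public using (blocks)
  open Pairing paired using (pairing; σ-pairing)
  open Inverse pairing using (strictlyInverseˡ; strictlyInverseʳ) renaming (to to φ; from to ψ)

  blocks*2≡n : blocks * 2 ≡ n
  blocks*2≡n = hasSize-unique (×-hasSize (↔-id _) 2↔Bool ⨾ Pointwise-≡↔≡ ⨾ pairing) (↔-id _)

  M : Matrix n
  M = I +ᴹ P σ

  M-symmetric : Symmetric M
  M-symmetric i j = cong₂ _+_ (δ-sym i j) (P-symmetric σ invol i j)

  δ-φ-sameSign : ∀ k l b → δ (φ (k , b)) (φ (l , b)) ≡ δ k l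
  δ-φ-sameSign k l b = δ-cong-⇔ {i = φ (k , b)} {φ (l , b)}
    (cong proj₁ ∘ ↔-injective pairing) (cong λ j → φ (j , b))

  δ-φ-otherSign : ∀ k l {b b′} → ¬ b ≡ b′ → δ (φ (k , b)) (φ (l , b′)) ≡ 0
  δ-φ-otherSign k l b≢b′ = δ-≢ (b≢b′ ∘ cong proj₂ ∘ ↔-injective pairing)

  M-φ : ∀ x y → M (φ x) (φ y) ≡ δ (proj₁ x) (proj₁ y)
  M-φ (k , b) (l , b′) with b Bool.≟ b′
  ... | yes refl = trans (cong₂ _+_ (δ-φ-sameSign k l b) σ-otherSign) (ℕ.+-identityʳ _)
    where
    σ-otherSign : δ (φ (k , b)) (σ ⟨$⟩ʳ φ (l , b)) ≡ 0
    σ-otherSign = trans (cong (δ (φ (k , b))) (σ-pairing l b)) (δ-φ-otherSign k l (not-¬ refl))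
  ... | no b≢b′ = cong₂ _+_ (δ-φ-otherSign k l b≢b′) σ-sameSign
    where
    σ-sameSign : δ (φ (k , b)) (σ ⟨$⟩ʳ φ (l , b′)) ≡ δ k l
    σ-sameSign = begin
      δ (φ (k , b)) (σ ⟨$⟩ʳ φ (l , b′))  ≡⟨ cong (δ (φ (k , b))) (σ-pairing l b′) ⟩
      δ (φ (k , b)) (φ (l , not b′))    ≡⟨ cong (λ c → δ (φ (k , c)) (φ (l , not b′))) (¬-not b≢b′) ⟩
      δ (φ (k , not b′)) (φ (l , not b′)) ≡⟨ δ-φ-sameSign k l (not b′) ⟩
      δ k l                             ∎
      where open ≡-Reasoning

  signedBlocks : Permutation′ blocks → (Fin blocks → Bool) → (Fin blocks × Bool) ↔ (Fin blocks × Bool)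
  signedBlocks π s = mk↔ₛ′ (λ (k , b) → π ⟨$⟩ʳ k , b xor s k) (λ (l , b) → π ⟨$⟩ˡ l , b xor s (π ⟨$⟩ˡ l))
    (λ (l , b) → cong₂ _,_ (Perm.inverseʳ π) (xor-cancelʳ b _))
    (λ (k , b) → cong₂ _,_ (Perm.inverseˡ π)
                           (trans (cong (λ j → (b xor s k) xor s j) (Perm.inverseˡ π)) (xor-cancelʳ b (s k))))

  signed : Permutation′ blocks → (Fin blocks → Bool) → Permutation′ n
  signed π s = Symmetry.inverse pairing ⨾ signedBlocks π s ⨾ pairing

  signed-φ : ∀ π s k b → signed π s ⟨$⟩ʳ φ (k , b) ≡ φ (π ⟨$⟩ʳ k , b xor s k)
  signed-φ π s k b = cong (φ ∘ Inverse.to (signedBlocks π s)) (strictlyInverseʳ (k , b))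

  signed-cong : ∀ π π′ s s′ → π ≈ₚ π′ → (∀ k → s k ≡ s′ k) → signed π s ≈ₚ signed π′ s′
  signed-cong π π′ s s′ π≈π′ s≗s′ i = cong φ (cong₂ _,_ (π≈π′ k) (cong (b xor_) (s≗s′ k)))
    where
    k : Fin blocks
    k = proj₁ (ψ i)
    b : Bool
    b = proj₂ (ψ i)

  signed-injective : ∀ π π′ s s′ → signed π s ≈ₚ signed π′ s′ → π ≈ₚ π′ × (∀ k → s k ≡ s′ k)
  signed-injective π π′ s s′ e = (λ k → cong proj₁ (same k)) , (λ k → cong proj₂ (same k))
    where
    same : ∀ k → (π ⟨$⟩ʳ k , s k) ≡ (π′ ⟨$⟩ʳ k , s′ k)
    same k = ↔-injective pairing (trans (sym (signed-φ π s k false)) (trans (e _) (signed-φ π′ s′ k false)))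

  invariant-on-blocks : ∀ α β → (∀ x y → M (α ⟨$⟩ʳ φ x) (β ⟨$⟩ʳ φ y) ≡ M (φ x) (φ y)) → Invariant α β M
  invariant-on-blocks α β inv i j = begin
    M (α ⟨$⟩ʳ i) (β ⟨$⟩ʳ j)              ≡⟨ cong₂ (λ i j → M (α ⟨$⟩ʳ i) (β ⟨$⟩ʳ j)) (strictlyInverseˡ i) (strictlyInverseˡ j) ⟨
    M (α ⟨$⟩ʳ φ (ψ i)) (β ⟨$⟩ʳ φ (ψ j))  ≡⟨ inv (ψ i) (ψ j) ⟩
    M (φ (ψ i)) (φ (ψ j))                ≡⟨ cong₂ M (strictlyInverseˡ i) (strictlyInverseˡ j) ⟩
    M i j                                ∎
    where open ≡-Reasoning

  signed-invariant : ∀ π s u → Invariant (signed π s) (signed π u) M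
  signed-invariant π s u = invariant-on-blocks (signed π s) (signed π u) λ (k , b) (l , c) → begin
    M (signed π s ⟨$⟩ʳ φ (k , b)) (signed π u ⟨$⟩ʳ φ (l , c)) ≡⟨ cong₂ M (signed-φ π s k b) (signed-φ π u l c) ⟩
    M (φ (π ⟨$⟩ʳ k , b xor s k)) (φ (π ⟨$⟩ʳ l , c xor u l))   ≡⟨ M-φ _ _ ⟩
    δ (π ⟨$⟩ʳ k) (π ⟨$⟩ʳ l)                                   ≡⟨ δ-cong-⇔ {i = π ⟨$⟩ʳ k} (↔-injective π) (cong (π ⟨$⟩ʳ_)) ⟩
    δ k l                                                     ≡⟨ M-φ (k , b) (l , c) ⟨
    M (φ (k , b)) (φ (l , c))                                 ∎
    where open ≡-Reasoning

  record SignedPair (α β : Permutation′ n) : Set where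
    field
      blockPerm : Permutation′ blocks
      signsˡ signsʳ : Fin blocks → Bool
      α≈signed : α ≈ₚ signed blockPerm signsˡ
      β≈signed : β ≈ₚ signed blockPerm signsʳ

  ≈ₚ-signed : ∀ α π s → (∀ k b → ψ (α ⟨$⟩ʳ φ (k , b)) ≡ (π ⟨$⟩ʳ k , b xor s k)) → α ≈ₚ signed π s
  ≈ₚ-signed α π s form i = begin
    α ⟨$⟩ʳ i                    ≡⟨ cong (α ⟨$⟩ʳ_) (strictlyInverseˡ i) ⟨
    α ⟨$⟩ʳ φ (ψ i)              ≡⟨ strictlyInverseˡ _ ⟨
    φ (ψ (α ⟨$⟩ʳ φ (ψ i)))      ≡⟨ cong φ (form (proj₁ (ψ i)) (proj₂ (ψ i))) ⟩
    signed π s ⟨$⟩ʳ i           ∎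
    where open ≡-Reasoning

  module BlockAnalysis (α β : Permutation′ n) (inv : Invariant α β M) where

    α̃ β̃ : Fin blocks × Bool → Fin blocks × Bool
    α̃ x = ψ (α ⟨$⟩ʳ φ x)
    β̃ x = ψ (β ⟨$⟩ʳ φ x)

    δ-blocks : ∀ x y → δ (proj₁ (α̃ x)) (proj₁ (β̃ y)) ≡ δ (proj₁ x) (proj₁ y)
    δ-blocks x y = begin
      δ (proj₁ (α̃ x)) (proj₁ (β̃ y)) ≡⟨ M-φ (α̃ x) (β̃ y) ⟨
      M (φ (α̃ x)) (φ (β̃ y))         ≡⟨ cong₂ M (strictlyInverseˡ _) (strictlyInverseˡ _) ⟩
      M (α ⟨$⟩ʳ φ x) (β ⟨$⟩ʳ φ y)   ≡⟨ inv (φ x) (φ y) ⟩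
      M (φ x) (φ y)                 ≡⟨ M-φ x y ⟩
      δ (proj₁ x) (proj₁ y)         ∎
      where open ≡-Reasoning

    sameBlock⇒ : ∀ x y → proj₁ x ≡ proj₁ y → proj₁ (α̃ x) ≡ proj₁ (β̃ y)
    sameBlock⇒ x y e = δ≡1⇒≡ (trans (δ-blocks x y) (δ-≡ e))

    sameBlock⇐ : ∀ x y → proj₁ (α̃ x) ≡ proj₁ (β̃ y) → proj₁ x ≡ proj₁ y
    sameBlock⇐ x y e = δ≡1⇒≡ (trans (sym (δ-blocks x y)) (δ-≡ e))

    πᶠ : Fin blocks → Fin blocks
    πᶠ k = proj₁ (α̃ (k , false))

    α̃-block : ∀ x → proj₁ (α̃ x) ≡ πᶠ (proj₁ x)
    α̃-block (k , b) = trans (sameBlock⇒ (k , b) (k , false) refl) (sym (sameBlock⇒ (k , false) (k , false) refl))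

    β̃-block : ∀ y → proj₁ (β̃ y) ≡ πᶠ (proj₁ y)
    β̃-block (k , b) = sym (sameBlock⇒ (k , false) (k , b) refl)

    πᶠ-injective : ∀ {k l} → πᶠ k ≡ πᶠ l → k ≡ l
    πᶠ-injective {k} {l} e = sameBlock⇐ (k , false) (l , false) (trans e (sym (β̃-block (l , false))))

    πᵇ : Fin blocks → Fin blocks
    πᵇ l = proj₁ (ψ (α ⟨$⟩ˡ φ (l , false)))

    πᶠ-πᵇ : ∀ l → πᶠ (πᵇ l) ≡ l
    πᶠ-πᵇ l = begin
      πᶠ (πᵇ l)                                ≡⟨ α̃-block (ψ (α ⟨$⟩ˡ φ (l , false))) ⟨
      proj₁ (α̃ (ψ (α ⟨$⟩ˡ φ (l , false))))     ≡⟨ cong (λ i → proj₁ (ψ (α ⟨$⟩ʳ i))) (strictlyInverseˡ _) ⟩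
      proj₁ (ψ (α ⟨$⟩ʳ (α ⟨$⟩ˡ φ (l , false)))) ≡⟨ cong (proj₁ ∘ ψ) (Perm.inverseʳ α) ⟩
      proj₁ (ψ (φ (l , false)))                ≡⟨ cong proj₁ (strictlyInverseʳ _) ⟩
      l                                        ∎
      where open ≡-Reasoning

    π : Permutation′ blocks
    π = permutation πᶠ πᵇ πᶠ-πᵇ (λ k → πᶠ-injective (πᶠ-πᵇ (πᶠ k)))

    conjugate-injective : ∀ γ {x y} → ψ (γ ⟨$⟩ʳ φ x) ≡ ψ (γ ⟨$⟩ʳ φ y) → x ≡ y
    conjugate-injective γ = ↔-injective pairing ∘ ↔-injective γ ∘ ↔-injective (Symmetry.inverse pairing)

    α̃-form : ∀ k b → α̃ (k , b) ≡ (π ⟨$⟩ʳ k , b xor proj₂ (α̃ (k , false)))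
    α̃-form k = pair-map-form α̃ (conjugate-injective α) k (α̃-block (k , true))

    β̃-form : ∀ k b → β̃ (k , b) ≡ (π ⟨$⟩ʳ k , b xor proj₂ (β̃ (k , false)))
    β̃-form k b = trans (pair-map-form β̃ (conjugate-injective β) k sameBlock b)
                       (cong (_, b xor proj₂ (β̃ (k , false))) (β̃-block (k , false)))
      where
      sameBlock : proj₁ (β̃ (k , true)) ≡ proj₁ (β̃ (k , false))
      sameBlock = trans (β̃-block (k , true)) (sym (β̃-block (k , false)))

  invariant⇒signed : ∀ α β → Invariant α β M → SignedPair α β
  invariant⇒signed α β inv = record
    { blockPerm = π
    ; signsˡ = λ k → proj₂ (α̃ (k , false))
    ; signsʳ = λ k → proj₂ (β̃ (k , false))
    ; α≈signed = ≈ₚ-signed α π _ α̃-form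
    ; β≈signed = ≈ₚ-signed β π _ β̃-form
    }
    where open BlockAnalysis α β inv

  -- (transpose flag, common block permutation, row signs, column signs)
  SignData : Setoid 0ℓ 0ℓ
  SignData = setoid Bool ×ₛ (Perms blocks ×ₛ (Bool^ blocks ×ₛ Bool^ blocks))

  stabilizer⇒signed : (g : Setoid.Carrier (Stabilizer M)) →
                      SignedPair (proj₁ (proj₂ (proj₁ g))) (proj₂ (proj₂ (proj₁ g)))
  stabilizer⇒signed ((t , α , β) , gM≈M) = invariant⇒signed α β (stabilizes⇒invariant M-symmetric t α β gM≈M)

  Stabilizer↔SignData : Inverse (Stabilizer M) SignData
  Stabilizer↔SignData = mk↔ₛ to from (λ {g} {h} → to-cong {g} {h}) (λ {d} {e} → from-cong {d} {e}) to-from from-to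
    where
    open Setoid (Stabilizer M) using () renaming (Carrier to StabilizerElement; _≈_ to _≈ₛ_)
    open Setoid SignData using () renaming (Carrier to SignDatum; _≈_ to _≈ᵈ_)

    to : StabilizerElement → SignDatum
    to g = proj₁ (proj₁ g) , blockPerm , signsˡ , signsʳ
      where open SignedPair (stabilizer⇒signed g)

    from : SignDatum → StabilizerElement
    from (t , π , s , u) = (t , signed π s , signed π u) ,
      invariant⇒stabilizes M-symmetric t (signed π s) (signed π u) (signed-invariant π s u)

    to-cong : ∀ {g h} → g ≈ₛ h → to g ≈ᵈ to h
    to-cong {g} {h} (t≡t′ , α≈α′ , β≈β′) = t≡t′ , proj₁ sameˡ , proj₂ sameˡ , proj₂ sameʳ
      where
      module G = SignedPair (stabilizer⇒signed g)
      module H = SignedPair (stabilizer⇒signed h)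
      sameˡ : G.blockPerm ≈ₚ H.blockPerm × (∀ k → G.signsˡ k ≡ H.signsˡ k)
      sameˡ = signed-injective G.blockPerm H.blockPerm G.signsˡ H.signsˡ
                (λ i → trans (sym (G.α≈signed i)) (trans (α≈α′ i) (H.α≈signed i)))
      sameʳ : G.blockPerm ≈ₚ H.blockPerm × (∀ k → G.signsʳ k ≡ H.signsʳ k)
      sameʳ = signed-injective G.blockPerm H.blockPerm G.signsʳ H.signsʳ
                (λ i → trans (sym (G.β≈signed i)) (trans (β≈β′ i) (H.β≈signed i)))

    from-cong : ∀ {d e} → d ≈ᵈ e → from d ≈ₛ from e
    from-cong {t , π , s , u} {t′ , π′ , s′ , u′} (t≡t′ , π≈π′ , s≗s′ , u≗u′) =
      t≡t′ , signed-cong π π′ s s′ π≈π′ s≗s′ , signed-cong π π′ u u′ π≈π′ u≗u′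

    to-from : ∀ d → to (from d) ≈ᵈ d
    to-from d@(t , π , s , u) = refl , proj₁ sameˡ , proj₂ sameˡ , proj₂ sameʳ
      where
      open SignedPair (stabilizer⇒signed (from d))
      sameˡ : blockPerm ≈ₚ π × (∀ k → signsˡ k ≡ s k)
      sameˡ = signed-injective blockPerm π signsˡ s (λ i → sym (α≈signed i))
      sameʳ : blockPerm ≈ₚ π × (∀ k → signsʳ k ≡ u k)
      sameʳ = signed-injective blockPerm π signsʳ u (λ i → sym (β≈signed i))

    from-to : ∀ g → from (to g) ≈ₛ g
    from-to g = refl , (λ i → sym (α≈signed i)) , (λ i → sym (β≈signed i))
      where open SignedPair (stabilizer⇒signed g)

  stabilizer-hasSize : HasSize (Stabilizer M) (2 * (blocks ! * (2 ^ blocks * 2 ^ blocks)))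
  stabilizer-hasSize =
    ×-hasSize 2↔Bool (×-hasSize (Perms-hasSize blocks) (×-hasSize (Bool^-hasSize blocks) (Bool^-hasSize blocks)))
    ⨾ Symmetry.inverse Stabilizer↔SignData

stabilizer-count : ∀ m → 2 * (m ! * (2 ^ m * 2 ^ m)) ≡ m ! * 2 ^ suc (2 * m)
stabilizer-count m = begin
  2 * (m ! * (2 ^ m * 2 ^ m))   ≡⟨ cong (λ x → 2 * (m ! * x)) (ℕ.^-distribˡ-+-* 2 m m) ⟨
  2 * (m ! * 2 ^ (m + m))       ≡⟨ *-left-comm 2 (m !) _ ⟩
  m ! * (2 * 2 ^ (m + m))       ≡⟨ cong (λ x → m ! * 2 ^ suc (m + x)) (ℕ.+-identityʳ m) ⟨
  m ! * 2 ^ suc (2 * m)         ∎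
  where open ≡-Reasoning

orbit-count : ∀ c m n → c * (m ! * 2 ^ suc n) ≡ 2 * (n ! * n !) → c ≡ orbitSize m n
orbit-count c m n c*s≡ = begin
  c                ≡⟨ m*n/n≡m c d ⟨
  c * d / d        ≡⟨ cong (_/ d) (ℕ.*-cancelˡ-≡ (c * d) (n ! * n !) 2 2cd≡) ⟩
  n ! * n ! / d    ∎
  where
  open ≡-Reasoning
  d : ℕ
  d = m ! * 2 ^ n
  instance
    d≢0 : NonZero d
    d≢0 = ℕ.m*n≢0 (m !) (2 ^ n) {{ℕ._!≢0 m}} {{ℕ.m^n≢0 2 n}}
  2cd≡ : 2 * (c * d) ≡ 2 * (n ! * n !)
  2cd≡ = trans (*-left-comm 2 c d) (trans (cong (c *_) (*-left-comm 2 (m !) (2 ^ n))) c*s≡)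

corollary4p7 : (m n : ℕ) → n ≡ 2 * m → (σ : Permutation′ n) →
    Derangement σ → Involution σ →
    HasSize (Stabilizer (I +ᴹ P σ)) (m ! * 2 ^ suc n)
    × HasSize (Orbit (I +ᴹ P σ)) (orbitSize m n)
corollary4p7 m n refl σ der invol = stabilizer , hasSize-cong (orbit-count c m n c*s≡) orbit
  where
  open PairedBlocks invol (pairing-of-fixedPointFree σ invol der)
  blocks≡m : blocks ≡ m
  blocks≡m = ℕ.*-cancelʳ-≡ blocks m 2 (trans blocks*2≡n (ℕ.*-comm 2 m))
  stabilizer : HasSize (Stabilizer M) (m ! * 2 ^ suc n)
  stabilizer = hasSize-cong (trans (cong (λ b → 2 * (b ! * (2 ^ b * 2 ^ b))) blocks≡m) (stabilizer-count m))
                            stabilizer-hasSize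
  open OrbitStabilizer M using (orbit-stabilizer)
  c : ℕ
  c = proj₁ (orbit-stabilizer stabilizer)
  orbit : HasSize (Orbit M) c
  orbit = proj₁ (proj₂ (orbit-stabilizer stabilizer))
  c*s≡ : c * (m ! * 2 ^ suc n) ≡ 2 * (n ! * n !)
  c*s≡ = proj₂ (proj₂ (orbit-stabilizer stabilizer))
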